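{- Let $\mathbb P=(P,\le,\Delta,f)$ be a forcing property such that every signature $\Delta_p$ ($p\in P$) is at most countable. Then every condition $p\in P$ belongs to some generic set $G\subseteq P$.
   Context: Transition algebra (TA). A signature $\Sigma=(S,F\supseteq M,L)$ consists of sorts $S$, function symbols $F$, monotonic function symbols $M\subseteq F$ and transition labels $L$; it is at most countable if $S$, $F$, $L$ are; signature morphisms are algebraic signature morphisms preserving monotonic symbols plus maps on labels. Actions: $\mathfrak a::=\lambda\mid\mathfrak a\mathbin{;}\mathfrak a\mid\mathfrak a\cup\mathfrak a\mid\mathfrak a^*$ ($\lambda\in L$); $\mathfrak a^n$ is the $n$-fold composition. $\Sigma$-sentences: $\phi::=t_1=t_2\mid t_1\stackrel{\mathfrak a}\Rightarrow t_2\mid\neg\phi\mid\bigvee\Phi\mid\exists X\,\phi'$ (ground terms $t_i$ of equal sort, finite $\Phi$, finite variable set $X$ added as new constants to give $\Sigma[X]$, $\phi'\in\mathrm{Sen}(\Sigma[X])$). $T_\Sigma$ denotes the ground terms; a substitution $\theta\colon X\to T_\Sigma$ maps $\phi'$ to $\theta(\phi')\in\mathrm{Sen}(\Sigma)$. Atomic sentences are $t_1=t_2$ and $t_1\stackrel{\lambda}\Rightarrow t_2$ ($\lambda\in L$); $\mathrm{Sen}_b(\Sigma)$ is their set. Models are many-sorted algebras (possibly empty carriers) with relations interpreting labels, monotone for symbols in $M$; $\models$ is the usual satisfaction. A forcing property is $\mathbb P=(P,\le,\Delta,f)$ where: $(P,\le)$ is a partial order with least element; $\Delta$ assigns to each $p$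 a signature $\Delta_p$ with $\Delta_p\subseteq\Delta_q$ whenever $p\le q$; $f(p)\subseteq\mathrm{Sen}_b(\Delta_p)$ with $f(p)\subseteq f(q)$ whenever $p\le q$; and for all atomic $\phi\in\mathrm{Sen}_b(\Delta_p)$, if $f(p)\models\phi$ then $\phi\in f(q)$ for some $q\ge p$. The forcing relation: $p\Vdash\varphi$ iff $\varphi\in f(p)$ for atomic $\varphi$; $p\Vdash t_1\stackrel{\mathfrak a_1;\mathfrak a_2}\Rightarrow t_2$ iff $p\Vdash t_1\stackrel{\mathfrak a_1}\Rightarrow t$ and $p\Vdash t\stackrel{\mathfrak a_2}\Rightarrow t_2$ for some $t\in T_{\Delta_p}$; $p\Vdash t_1\stackrel{\mathfrak a_1\cup\mathfrak a_2}\Rightarrow t_2$ iff $p$ forces one of $t_1\stackrel{\mathfrak a_i}\Rightarrow t_2$; $p\Vdash t_1\stackrel{\mathfrak a^*}\Rightarrow t_2$ iff $p\Vdash t_1\stackrel{\mathfrak a^n}\Rightarrow t_2$ for some $n$; $p\Vdash\neg\phi$ iff no $q\ge p$ has $q\Vdash\phi$; $p\Vdash\bigvee\Phi$ iff $p\Vdash\phi$ for some $\phi\in\Phi$; $p\Vdash\exists X\phi$ iff $p\Vdash\theta(\phi)$ for some $\theta\colon X\to T_{\Delta_p}$. A subset $G\subseteq P$ is generic if (1) $G$ is an ideal: it is downward closed and any two elements of $G$ have an upper bound in $G$; and (2) for all $p\in G$ and all $\phi\in\mathrm{Sen}(\Delta_p)$ there is $q\in G$ with $q\ge p$ and either $q\Vdash\phi$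 or $q\Vdash\neg\phi$. -}

module Defs where

open import Level using (0ℓ)
open import Data.Nat using (ℕ; zero; suc)
open import Data.Empty using (⊥)
open import Data.Unit using (⊤)
open import Data.Product using (Σ; _×_; _,_)
open import Data.Sum using (_⊎_)
open import Data.List using (List; []; _∷_; _++_)
open import Data.List.Membership.Propositional using (_∈_)
open import Data.List.Relation.Unary.All using (All; []; _∷_; lookup)
open import Data.List.Relation.Unary.All.Properties using (++⁺)
open import Relation.Binary.PropositionalEquality using (_≡_)
open import Relation.Binary.Structures using (IsPartialOrder)
open import Relation.Nullary using (¬_)

-- Every signature Δ_p of a forcing property is a
-- sub-signature of one ambient signature (e.g. the union of all Δ_p);
-- Δ_p ⊆ Δ_q is then literal inclusion of sub-signatures.

record Sig : Set₁ where
  field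
    Sort  : Set
    Op    : List Sort → Sort → Set
    Label : Set

module _ {A : Sig} where
  open Sig A

  record SubSig : Set₁ where
    field
      sort∈       : Sort → Set
      sort∈-prop  : ∀ {s} (x y : sort∈ s) → x ≡ y
      op∈         : ∀ {w s} → Op w s → Set
      op∈-prop    : ∀ {w s} {σ : Op w s} (x y : op∈ σ) → x ≡ y
      mono∈       : ∀ {w s} → Op w s → Set
      mono∈-prop  : ∀ {w s} {σ : Op w s} (x y : mono∈ σ) → x ≡ y
      mono⊆op     : ∀ {w s} {σ : Op w s} → mono∈ σ → op∈ σ
      label∈      : Label → Set
      label∈-prop : ∀ {l} (x y : label∈ l) → x ≡ y
      op-arity    : ∀ {w s} {σ : Op w s} → op∈ σ → All sort∈ w
      op-sort     : ∀ {w s} {σ : Op w s} → op∈ σ → sort∈ s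
  open SubSig public

  record _⊆Sig_ (D E : SubSig) : Set where
    field
      sort⊆  : ∀ {s} → sort∈ D s → sort∈ E s
      op⊆    : ∀ {w s} {σ : Op w s} → op∈ D σ → op∈ E σ
      mono⊆  : ∀ {w s} {σ : Op w s} → mono∈ D σ → mono∈ E σ
      label⊆ : ∀ {l} → label∈ D l → label∈ E l

  record AtMostCountable (D : SubSig) : Set where
    field
      sortCode  : (s : Sort) → sort∈ D s → ℕ
      sortInj   : ∀ {s s'} (x : sort∈ D s) (y : sort∈ D s') →
                  sortCode s x ≡ sortCode s' y → s ≡ s'
      opCode    : ∀ {w s} (σ : Op w s) → op∈ D σ → ℕ
      opInj     : ∀ {w s w' s'} {σ : Op w s} {σ' : Op w' s'}
                  (x : op∈ D σ) (y : op∈ D σ') → opCode σ x ≡ opCode σ' y →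
                  _≡_ {A = Σ (List Sort) (λ v → Σ Sort (Op v))} (w , s , σ) (w' , s' , σ')
      labelCode : (l : Label) → label∈ D l → ℕ
      labelInj  : ∀ {l l'} (x : label∈ D l) (y : label∈ D l') →
                  labelCode l x ≡ labelCode l' y → l ≡ l'

  -- Terms over the ambient signature extended with a context Γ of
  -- variables (the new constants X); Γ = [] gives ground terms.

  data Term (Γ : List Sort) : Sort → Set
  data Terms (Γ : List Sort) : List Sort → Set

  data Term Γ where
    var : ∀ {s} → s ∈ Γ → Term Γ s
    op  : ∀ {w s} → Op w s → Terms Γ w → Term Γ s

  data Terms Γ where
    []ₜ  : Terms Γ []
    _∷ₜ_ : ∀ {s w} → Term Γ s → Terms Γ w → Terms Γ (s ∷ w)

  GTerm : Sort → Set
  GTerm = Term []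

  Env : List Sort → Set
  Env Γ = All GTerm Γ

  sub  : ∀ {Γ s} → Env Γ → Term Γ s → GTerm s
  subs : ∀ {Γ w} → Env Γ → Terms Γ w → Terms [] w
  sub ρ (var x)   = lookup ρ x
  sub ρ (op σ ts) = op σ (subs ρ ts)
  subs ρ []ₜ       = []ₜ
  subs ρ (t ∷ₜ ts) = sub ρ t ∷ₜ subs ρ ts

  InT  : ∀ {Γ s} → SubSig → Term Γ s → Set
  InTs : ∀ {Γ w} → SubSig → Terms Γ w → Set
  InT D (var x)   = ⊤
  InT D (op σ ts) = op∈ D σ × InTs D ts
  InTs D []ₜ       = ⊤
  InTs D (t ∷ₜ ts) = InT D t × InTs D ts

  EnvIn : ∀ {Γ} → SubSig → Env Γ → Set
  EnvIn D []       = ⊤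
  EnvIn D (t ∷ ρ)  = InT D t × EnvIn D ρ

  infixl 6 _⨾_
  infixl 5 _∪_
  data Action : Set where
    lab  : Label → Action
    _⨾_  : Action → Action → Action
    _∪_  : Action → Action → Action
    _*   : Action → Action

  data Sen (Γ : List Sort) : Set where
    _≐_     : ∀ {s} → Term Γ s → Term Γ s → Sen Γ
    _⟨_⟩⇒_  : ∀ {s} → Term Γ s → Action → Term Γ s → Sen Γ
    ¬ₛ_     : Sen Γ → Sen Γ
    ⋁_      : List (Sen Γ) → Sen Γ
    ∃ₛ      : (X : List Sort) → Sen (Γ ++ X) → Sen Γ

  ActIn : SubSig → Action → Set
  ActIn D (lab l) = label∈ D l
  ActIn D (a ⨾ b) = ActIn D a × ActIn D b
  ActIn D (a ∪ b) = ActIn D a × ActIn D b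
  ActIn D (a *)   = ActIn D a

  SenIn  : ∀ {Γ} → SubSig → Sen Γ → Set
  SensIn : ∀ {Γ} → SubSig → List (Sen Γ) → Set
  SenIn D (t ≐ u)       = InT D t × InT D u
  SenIn D (t ⟨ a ⟩⇒ u)  = InT D t × ActIn D a × InT D u
  SenIn D (¬ₛ φ)        = SenIn D φ
  SenIn D (⋁ Φ)         = SensIn D Φ
  SenIn D (∃ₛ X φ)      = All (sort∈ D) X × SenIn D φ
  SensIn D []       = ⊤
  SensIn D (φ ∷ Φ)  = SenIn D φ × SensIn D Φ

  data Atom : Set where
    eqA : ∀ {s} → GTerm s → GTerm s → Atom
    trA : ∀ {s} → Label → GTerm s → GTerm s → Atom

  AtomIn : SubSig → Atom → Set
  AtomIn D (eqA t u)   = InT D t × InT D u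
  AtomIn D (trA l t u) = label∈ D l × InT D t × InT D u

  Args : (Sort → Set) → List Sort → Set
  Args C w = All C w

  RelArgs : ∀ {C : Sort → Set} (R : ∀ {s} → C s → C s → Set) {w} →
            Args C w → Args C w → Set
  RelArgs R []       []       = ⊤
  RelArgs R (a ∷ as) (b ∷ bs) = R a b × RelArgs R as bs

  record Model (D : SubSig) : Set₁ where
    field
      Carrier : Sort → Set
      ⟦_⟧     : ∀ {w s} (σ : Op w s) → op∈ D σ → Args Carrier w → Carrier s
      ⟦_⟧ʳ    : (l : Label) → label∈ D l → ∀ {s} → Carrier s → Carrier s → Set
      monotone : ∀ {w s} (σ : Op w s) (m : mono∈ D σ) (l : Label) (hl : label∈ D l)
                 (as bs : Args Carrier w) → RelArgs (⟦ l ⟧ʳ hl) as bs →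
                 ⟦ l ⟧ʳ hl (⟦ σ ⟧ (mono⊆op D m) as) (⟦ σ ⟧ (mono⊆op D m) bs)

  module _ {D : SubSig} (M : Model D) where
    open Model M
    eval  : ∀ {s} (t : GTerm s) → InT D t → Carrier s
    evals : ∀ {w} (ts : Terms [] w) → InTs D ts → Args Carrier w
    eval (var ())
    eval (op σ ts) (h , hs) = ⟦ σ ⟧ h (evals ts hs)
    evals []ₜ       _        = []
    evals (t ∷ₜ ts) (h , hs) = eval t h ∷ evals ts hs

    SatA : (φ : Atom) → AtomIn D φ → Set
    SatA (eqA t u)   (ht , hu)      = eval t ht ≡ eval u hu
    SatA (trA l t u) (hl , ht , hu) = ⟦ l ⟧ʳ hl (eval t ht) (eval u hu)

  Entails : (D : SubSig) (Γ : Atom → Set) (Γ⊆ : ∀ {ψ} → Γ ψ → AtomIn D ψ)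
            (φ : Atom) → AtomIn D φ → Set₁
  Entails D Γ Γ⊆ φ hφ =
    (M : Model D) → (∀ ψ (h : Γ ψ) → SatA M ψ (Γ⊆ h)) → SatA M φ hφ

  record ForcingProperty : Set₁ where
    field
      P              : Set
      _≤_            : P → P → Set
      ≤-isPartialOrder : IsPartialOrder _≡_ _≤_
      ⊥ₚ             : P
      ⊥ₚ-least       : ∀ p → ⊥ₚ ≤ p
      Δ              : P → SubSig
      Δ-mono         : ∀ {p q} → p ≤ q → Δ p ⊆Sig Δ q
      f              : P → Atom → Set
      f⊆Sen          : ∀ {p φ} → f p φ → AtomIn (Δ p) φ
      f-mono         : ∀ {p q φ} → p ≤ q → f p φ → f q φ
      f-complete     : ∀ p φ (hφ : AtomIn (Δ p) φ) →
                       Entails (Δ p) (f p) f⊆Sen φ hφ →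
                       Σ P (λ q → p ≤ q × f q φ)

  -- The forcing relation.  Force p φ ρ is  p ⊩ ρ(φ)  for φ over the
  -- variables Γ and a substitution ρ : Γ → T; for a sentence φ : Sen []
  -- p ⊩ φ is Force p φ [].

  module _ (ℙ : ForcingProperty) where
    open ForcingProperty ℙ

    Iter : ∀ {s} (p : P) → (GTerm s → GTerm s → Set) → ℕ → GTerm s → GTerm s → Set
    Iter p R zero          t u = f p (eqA t u)
    Iter p R (suc zero)    t u = R t u
    Iter {s} p R (suc (suc n)) t u =
      Σ (GTerm s) λ v → InT (Δ p) v × R t v × Iter p R (suc n) v u

    FTr : ∀ {s} (p : P) → Action → GTerm s → GTerm s → Set
    FTr p (lab l) t u = f p (trA l t u)
    FTr {s} p (a ⨾ b) t u = Σ (GTerm s) λ v → InT (Δ p) v × FTr p a t v × FTr p b v u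
    FTr p (a ∪ b) t u = FTr p a t u ⊎ FTr p b t u
    FTr p (a *) t u   = Σ ℕ λ n → Iter p (FTr p a) n t u

    Force    : ∀ {Γ} (p : P) → Sen Γ → Env Γ → Set
    ForceAny : ∀ {Γ} (p : P) → List (Sen Γ) → Env Γ → Set
    Force p (t ≐ u) ρ      = f p (eqA (sub ρ t) (sub ρ u))
    Force p (t ⟨ a ⟩⇒ u) ρ = FTr p a (sub ρ t) (sub ρ u)
    Force p (¬ₛ φ) ρ       = ∀ q → p ≤ q → ¬ Force q φ ρ
    Force p (⋁ Φ) ρ        = ForceAny p Φ ρ
    Force p (∃ₛ X φ) ρ     = Σ (Env X) λ θ → EnvIn (Δ p) θ × Force p φ (++⁺ ρ θ)
    ForceAny p [] ρ        = ⊥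
    ForceAny p (φ ∷ Φ) ρ   = Force p φ ρ ⊎ ForceAny p Φ ρ

    _⊩_ : P → Sen [] → Set
    p ⊩ φ = Force p φ []

    record Generic (G : P → Set) : Set where
      field
        down     : ∀ {p q} → G q → p ≤ q → G p
        directed : ∀ {p q} → G p → G q → Σ P (λ r → G r × p ≤ r × q ≤ r)
        decides  : ∀ {p} → G p → (φ : Sen []) → SenIn (Δ p) φ →
                   Σ P (λ q → G q × p ≤ q × (q ⊩ φ ⊎ q ⊩ (¬ₛ φ)))

-- Through finite trees of naturals, the sentences over a countable
-- signature inject into ℕ.  Starting from p, build a chain
-- p = p₀ ⊑ p₁ ⊑ ⋯ in which stage m + 1 decides the sentence with code k over
-- Δ (p n), where (n , k) is the m-th pair of naturals; excluded middle lets a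
-- condition decide φ, since either some extension forces φ or the condition
-- itself forces ¬φ.  The downward closure G of the chain is an ideal, and a
-- sentence φ over Δ q with q ⊑ p n is a sentence over Δ (p n), so it has a
-- code k there and is decided by the stage handling (n , k).
module Submission where

open import Defs
open import Level using (0ℓ)
open import Axiom.ExcludedMiddle using (ExcludedMiddle)
open import Data.Fin using (toℕ)
open import Data.Fin.Properties using (toℕ-injective) renaming (suc-injective to Fin-suc-injective)
open import Data.List using (List; []; _∷_)
open import Data.List.Membership.Propositional using (_∈_)
open import Data.List.Relation.Unary.All using (All; []; _∷_)
import Data.List.Relation.Unary.All as All
open import Data.List.Relation.Unary.Any using (here; there; index)
open import Data.Nat using (ℕ; zero; suc; _+_; _≤_; _≤′_; ≤′-reflexive; ≤′-step; _⊔_; z≤n; s≤s; _≤?_)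
open import Data.Nat.Properties
  using (+-suc; +-identityʳ; suc-injective; ≤-antisym; ≰⇒>; 1+n≰n; m≤m⊔n; m≤n⊔m; ≤⇒≤′)
open import Data.Product using (Σ; ∃; _×_; _,_; proj₁; proj₂)
open import Data.Product.Properties using (,-injective)
open import Data.Sum using (_⊎_; inj₁; inj₂)
open import Data.Unit using (tt)
open import Relation.Binary.PropositionalEquality using (_≡_; refl; sym; trans; cong; subst)
open import Relation.Binary.Structures using (IsPartialOrder)
open import Relation.Nullary using (yes; no; contradiction)

-- Enumeration of ℕ × ℕ along the diagonals n + k = d, with n increasing.

nextPair : ℕ × ℕ → ℕ × ℕ
nextPair (n , zero)  = zero , suc n
nextPair (n , suc k) = suc n , k

unpair : ℕ → ℕ × ℕ
unpair zero    = zero , zero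
unpair (suc m) = nextPair (unpair m)

unpair-walk : ∀ i {m n k} → unpair m ≡ (n , i + k) → unpair (i + m) ≡ (i + n , k)
unpair-walk zero    e = e
unpair-walk (suc i) {n = n} {k} e =
  cong nextPair (unpair-walk i (trans e (cong (n ,_) (sym (+-suc i k)))))

unpair-diagonal : ∀ d → ∃ λ m → unpair m ≡ (zero , d)
unpair-diagonal zero = zero , refl
unpair-diagonal (suc d) with unpair-diagonal d
... | m , e rewrite sym (+-identityʳ d) = suc (d + m) , cong nextPair (unpair-walk d e)

unpair-surjective : ∀ x → ∃ λ m → unpair m ≡ x
unpair-surjective (n , k) with unpair-diagonal (n + k)
... | m , e = n + m , subst (λ n′ → unpair (n + m) ≡ (n′ , k)) (+-identityʳ n) (unpair-walk n e)

unpair-proj₁-≤ : ∀ m → proj₁ (unpair m) ≤ m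
unpair-proj₁-≤ zero = z≤n
unpair-proj₁-≤ (suc m) with unpair m | unpair-proj₁-≤ m
... | n , zero  | _   = z≤n
... | n , suc k | n≤m = s≤s n≤m

pair : ℕ × ℕ → ℕ
pair x = proj₁ (unpair-surjective x)

pair-injective : ∀ {x y} → pair x ≡ pair y → x ≡ y
pair-injective {x} {y} e =
  trans (sym (proj₂ (unpair-surjective x))) (trans (cong unpair e) (proj₂ (unpair-surjective y)))

data Tree : Set where
  leaf : ℕ → Tree
  node : Tree → Tree → Tree

node-injective : ∀ {a b a′ b′} → node a b ≡ node a′ b′ → a ≡ a′ × b ≡ b′
node-injective refl = refl , refl

leaf-injective : ∀ {n n′} → leaf n ≡ leaf n′ → n ≡ n′
leaf-injective refl = refl

treeCode : Tree → ℕ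
treeShape : Tree → ℕ × ℕ
treeCode t = pair (treeShape t)
treeShape (leaf n)   = zero , n
treeShape (node a b) = suc (treeCode a) , treeCode b

treeCode-injective : ∀ {a b} → treeCode a ≡ treeCode b → a ≡ b
treeShape-injective : ∀ {a b} → treeShape a ≡ treeShape b → a ≡ b
treeCode-injective {a} {b} e = treeShape-injective (pair-injective {treeShape a} {treeShape b} e)
treeShape-injective {leaf n} {leaf .n} refl = refl
treeShape-injective {node a b} {node a′ b′} e with ,-injective e
... | ea , eb with treeCode-injective {a} {a′} (suc-injective ea) | treeCode-injective {b} {b′} eb
... | refl | refl = refl

∈-index-injective : ∀ {T : Set} {x y : T} {xs} (x∈ : x ∈ xs) (y∈ : y ∈ xs) →
                    index x∈ ≡ index y∈ → _≡_ {A = Σ T (_∈ xs)} (x , x∈) (y , y∈)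
∈-index-injective (here refl) (here refl) _ = refl
∈-index-injective (there x∈) (there y∈) e with ∈-index-injective x∈ y∈ (Fin-suc-injective e)
... | refl = refl

module SentenceCode {A : Sig} (D : SubSig {A}) (countable : AtMostCountable D) where
  open Sig A
  open AtMostCountable countable

  termTree  : ∀ {Γ s} (t : Term Γ s) → InT D t → Tree
  termsTree : ∀ {Γ w} (ts : Terms Γ w) → InTs D ts → Tree
  termTree (var x)   _        = node (leaf 0) (leaf (toℕ (index x)))
  termTree (op σ ts) (σ∈ , h) = node (leaf 1) (node (leaf (opCode σ σ∈)) (termsTree ts h))
  termsTree []ₜ       _        = leaf 0
  termsTree (t ∷ₜ ts) (ht , h) = node (termTree t ht) (termsTree ts h)

  termTree-injective : ∀ {Γ s s′} (t : Term Γ s) (t′ : Term Γ s′) h h′ →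
                       termTree t h ≡ termTree t′ h′ →
                       _≡_ {A = Σ Sort (Term Γ)} (s , t) (s′ , t′)
  termsTree-injective : ∀ {Γ w w′} (ts : Terms Γ w) (ts′ : Terms Γ w′) h h′ →
                        termsTree ts h ≡ termsTree ts′ h′ →
                        _≡_ {A = Σ (List Sort) (Terms Γ)} (w , ts) (w′ , ts′)
  termTree-injective (var x) (var x′) _ _ e
    with ∈-index-injective x x′ (toℕ-injective (leaf-injective (proj₂ (node-injective e))))
  ... | refl = refl
  termTree-injective (op σ ts) (op σ′ ts′) (σ∈ , h) (σ∈′ , h′) e
    with node-injective (proj₂ (node-injective e))
  ... | eσ , ets with opInj σ∈ σ∈′ (leaf-injective eσ)
  ... | refl with termsTree-injective ts ts′ h h′ ets
  ... | refl = refl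
  termTree-injective (var _)  (op _ _) _ _ ()
  termTree-injective (op _ _) (var _)  _ _ ()
  termsTree-injective []ₜ       []ₜ         _        _          _ = refl
  termsTree-injective (t ∷ₜ ts) (t′ ∷ₜ ts′) (ht , h) (ht′ , h′) e
    with termTree-injective t t′ ht ht′ (proj₁ (node-injective e))
       | termsTree-injective ts ts′ h h′ (proj₂ (node-injective e))
  ... | refl | refl = refl

  actionTree : (a : Action) → ActIn D a → Tree
  actionTree (lab l) l∈       = node (leaf 0) (leaf (labelCode l l∈))
  actionTree (a ⨾ b) (ha , hb) = node (leaf 1) (node (actionTree a ha) (actionTree b hb))
  actionTree (a ∪ b) (ha , hb) = node (leaf 2) (node (actionTree a ha) (actionTree b hb))
  actionTree (a *)   ha        = node (leaf 3) (actionTree a ha)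

  actionTree-injective : ∀ a a′ h h′ → actionTree a h ≡ actionTree a′ h′ → a ≡ a′
  actionTree-injective (lab l) (lab l′) h h′ e
    with labelInj h h′ (leaf-injective (proj₂ (node-injective e)))
  ... | refl = refl
  actionTree-injective (a ⨾ b) (a′ ⨾ b′) (ha , hb) (ha′ , hb′) e
    with node-injective (proj₂ (node-injective e))
  ... | ea , eb with actionTree-injective a a′ ha ha′ ea | actionTree-injective b b′ hb hb′ eb
  ... | refl | refl = refl
  actionTree-injective (a ∪ b) (a′ ∪ b′) (ha , hb) (ha′ , hb′) e
    with node-injective (proj₂ (node-injective e))
  ... | ea , eb with actionTree-injective a a′ ha ha′ ea | actionTree-injective b b′ hb hb′ eb
  ... | refl | refl = refl
  actionTree-injective (a *) (a′ *) h h′ e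
    with actionTree-injective a a′ h h′ (proj₂ (node-injective e))
  ... | refl = refl
  actionTree-injective (lab _) (_ ⨾ _) _ _ ()
  actionTree-injective (lab _) (_ ∪ _) _ _ ()
  actionTree-injective (lab _) (_ *)   _ _ ()
  actionTree-injective (_ ⨾ _) (lab _) _ _ ()
  actionTree-injective (_ ⨾ _) (_ ∪ _) _ _ ()
  actionTree-injective (_ ⨾ _) (_ *)   _ _ ()
  actionTree-injective (_ ∪ _) (lab _) _ _ ()
  actionTree-injective (_ ∪ _) (_ ⨾ _) _ _ ()
  actionTree-injective (_ ∪ _) (_ *)   _ _ ()
  actionTree-injective (_ *)   (lab _) _ _ ()
  actionTree-injective (_ *)   (_ ⨾ _) _ _ ()
  actionTree-injective (_ *)   (_ ∪ _) _ _ ()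

  sortsTree : (X : List Sort) → All (sort∈ D) X → Tree
  sortsTree []      _         = leaf 0
  sortsTree (s ∷ X) (s∈ ∷ X∈) = node (leaf (sortCode s s∈)) (sortsTree X X∈)

  sortsTree-injective : ∀ X X′ h h′ → sortsTree X h ≡ sortsTree X′ h′ → X ≡ X′
  sortsTree-injective []      []        _         _           _  = refl
  sortsTree-injective []      (_ ∷ _)   []        (_ ∷ _)     ()
  sortsTree-injective (_ ∷ _) []        (_ ∷ _)   []          ()
  sortsTree-injective (s ∷ X) (s′ ∷ X′) (s∈ ∷ X∈) (s∈′ ∷ X∈′) e
    with sortInj s∈ s∈′ (leaf-injective (proj₁ (node-injective e)))
       | sortsTree-injective X X′ X∈ X∈′ (proj₂ (node-injective e))
  ... | refl | refl = refl

  senTree  : ∀ {Γ} (φ : Sen Γ) → SenIn D φ → Tree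
  sensTree : ∀ {Γ} (Φ : List (Sen Γ)) → SensIn D Φ → Tree
  senTree (t ≐ u)      (ht , hu)      = node (leaf 0) (node (termTree t ht) (termTree u hu))
  senTree (t ⟨ a ⟩⇒ u) (ht , ha , hu) =
    node (leaf 1) (node (termTree t ht) (node (actionTree a ha) (termTree u hu)))
  senTree (¬ₛ φ)       h              = node (leaf 2) (senTree φ h)
  senTree (⋁ Φ)        h              = node (leaf 3) (sensTree Φ h)
  senTree (∃ₛ X φ)     (hX , h)       = node (leaf 4) (node (sortsTree X hX) (senTree φ h))
  sensTree []      _        = leaf 0
  sensTree (φ ∷ Φ) (h , hs) = node (senTree φ h) (sensTree Φ hs)

  senTree-injective  : ∀ {Γ} (φ φ′ : Sen Γ) h h′ → senTree φ h ≡ senTree φ′ h′ → φ ≡ φ′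
  sensTree-injective : ∀ {Γ} (Φ Φ′ : List (Sen Γ)) h h′ → sensTree Φ h ≡ sensTree Φ′ h′ → Φ ≡ Φ′
  senTree-injective (t ≐ u) (t′ ≐ u′) (ht , hu) (ht′ , hu′) e
    with node-injective (proj₂ (node-injective e))
  ... | et , eu with termTree-injective t t′ ht ht′ et
  ... | refl with termTree-injective u u′ hu hu′ eu
  ... | refl = refl
  senTree-injective (t ⟨ a ⟩⇒ u) (t′ ⟨ a′ ⟩⇒ u′) (ht , ha , hu) (ht′ , ha′ , hu′) e
    with node-injective (proj₂ (node-injective e))
  ... | et , eau with node-injective eau | termTree-injective t t′ ht ht′ et
  ... | ea , eu | refl with actionTree-injective a a′ ha ha′ ea | termTree-injective u u′ hu hu′ eu
  ... | refl | refl = refl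
  senTree-injective (¬ₛ φ) (¬ₛ φ′) h h′ e =
    cong ¬ₛ_ (senTree-injective φ φ′ h h′ (proj₂ (node-injective e)))
  senTree-injective (⋁ Φ) (⋁ Φ′) h h′ e =
    cong ⋁_ (sensTree-injective Φ Φ′ h h′ (proj₂ (node-injective e)))
  senTree-injective (∃ₛ X φ) (∃ₛ X′ φ′) (hX , h) (hX′ , h′) e
    with node-injective (proj₂ (node-injective e))
  ... | eX , eφ with sortsTree-injective X X′ hX hX′ eX
  ... | refl = cong (∃ₛ X) (senTree-injective φ φ′ h h′ eφ)
  senTree-injective (_ ≐ _)      (_ ⟨ _ ⟩⇒ _) _ _ ()
  senTree-injective (_ ≐ _)      (¬ₛ _)       _ _ ()
  senTree-injective (_ ≐ _)      (⋁ _)        _ _ ()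
  senTree-injective (_ ≐ _)      (∃ₛ _ _)     _ _ ()
  senTree-injective (_ ⟨ _ ⟩⇒ _) (_ ≐ _)      _ _ ()
  senTree-injective (_ ⟨ _ ⟩⇒ _) (¬ₛ _)       _ _ ()
  senTree-injective (_ ⟨ _ ⟩⇒ _) (⋁ _)        _ _ ()
  senTree-injective (_ ⟨ _ ⟩⇒ _) (∃ₛ _ _)     _ _ ()
  senTree-injective (¬ₛ _)       (_ ≐ _)      _ _ ()
  senTree-injective (¬ₛ _)       (_ ⟨ _ ⟩⇒ _) _ _ ()
  senTree-injective (¬ₛ _)       (⋁ _)        _ _ ()
  senTree-injective (¬ₛ _)       (∃ₛ _ _)     _ _ ()
  senTree-injective (⋁ _)        (_ ≐ _)      _ _ ()
  senTree-injective (⋁ _)        (_ ⟨ _ ⟩⇒ _) _ _ ()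
  senTree-injective (⋁ _)        (¬ₛ _)       _ _ ()
  senTree-injective (⋁ _)        (∃ₛ _ _)     _ _ ()
  senTree-injective (∃ₛ _ _)     (_ ≐ _)      _ _ ()
  senTree-injective (∃ₛ _ _)     (_ ⟨ _ ⟩⇒ _) _ _ ()
  senTree-injective (∃ₛ _ _)     (¬ₛ _)       _ _ ()
  senTree-injective (∃ₛ _ _)     (⋁ _)        _ _ ()
  sensTree-injective []      []        _        _          _ = refl
  sensTree-injective (φ ∷ Φ) (φ′ ∷ Φ′) (h , hs) (h′ , hs′) e
    with senTree-injective φ φ′ h h′ (proj₁ (node-injective e))
       | sensTree-injective Φ Φ′ hs hs′ (proj₂ (node-injective e))
  ... | refl | refl = refl

  senCode : (φ : Sen []) → SenIn D φ → ℕ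
  senCode φ h = treeCode (senTree φ h)

  senCode-injective : ∀ φ φ′ h h′ → senCode φ h ≡ senCode φ′ h′ → φ ≡ φ′
  senCode-injective φ φ′ h h′ e = senTree-injective φ φ′ h h′ (treeCode-injective e)

module _ {A : Sig} {D E : SubSig {A}} (D⊆E : D ⊆Sig E) where
  open _⊆Sig_ D⊆E

  InT-mono  : ∀ {Γ s} (t : Term Γ s) → InT D t → InT E t
  InTs-mono : ∀ {Γ w} (ts : Terms Γ w) → InTs D ts → InTs E ts
  InT-mono (var _)   _        = tt
  InT-mono (op _ ts) (σ∈ , h) = op⊆ σ∈ , InTs-mono ts h
  InTs-mono []ₜ       _        = tt
  InTs-mono (t ∷ₜ ts) (ht , h) = InT-mono t ht , InTs-mono ts h

  ActIn-mono : ∀ a → ActIn D a → ActIn E a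
  ActIn-mono (lab _) l∈        = label⊆ l∈
  ActIn-mono (a ⨾ b) (ha , hb) = ActIn-mono a ha , ActIn-mono b hb
  ActIn-mono (a ∪ b) (ha , hb) = ActIn-mono a ha , ActIn-mono b hb
  ActIn-mono (a *)   ha        = ActIn-mono a ha

  SenIn-mono  : ∀ {Γ} (φ : Sen Γ) → SenIn D φ → SenIn E φ
  SensIn-mono : ∀ {Γ} (Φ : List (Sen Γ)) → SensIn D Φ → SensIn E Φ
  SenIn-mono (t ≐ u)      (ht , hu)      = InT-mono t ht , InT-mono u hu
  SenIn-mono (t ⟨ a ⟩⇒ u) (ht , ha , hu) = InT-mono t ht , ActIn-mono a ha , InT-mono u hu
  SenIn-mono (¬ₛ φ)       h              = SenIn-mono φ h
  SenIn-mono (⋁ Φ)        h              = SensIn-mono Φ h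
  SenIn-mono (∃ₛ _ φ)     (hX , h)       = All.map sort⊆ hX , SenIn-mono φ h
  SensIn-mono []      _        = tt
  SensIn-mono (φ ∷ Φ) (h , hs) = SenIn-mono φ h , SensIn-mono Φ hs

-- `table m i` is stage i only for i ≤ m; later entries are junk.
module CourseOfValues {X : Set} (x₀ : X) (next : ℕ → (ℕ → X) → X) where

  table : ℕ → ℕ → X
  table zero    _ = x₀
  table (suc m) i with i ≤? m
  ... | yes _ = table m i
  ... | no  _ = next m (table m)

  value : ℕ → X
  value m = table m m

  value-suc : ∀ m → value (suc m) ≡ next m (table m)
  value-suc m with suc m ≤? m
  ... | yes 1+m≤m = contradiction 1+m≤m 1+n≰n
  ... | no  _     = refl

  table-stable : ∀ {m i} → i ≤ m → table m i ≡ value i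
  table-stable {zero}  z≤n = refl
  table-stable {suc m} {i} i≤1+m with i ≤? m
  ... | yes i≤m = table-stable i≤m
  ... | no  i≰m rewrite ≤-antisym i≤1+m (≰⇒> i≰m) = sym (value-suc m)

module _ {A : Sig} (ℙ : ForcingProperty {A}) where
  open ForcingProperty ℙ renaming (_≤_ to _⊑_)
  open IsPartialOrder ≤-isPartialOrder using () renaming (refl to ⊑-refl)

  Decides : P → Sen [] → Set
  Decides q φ = _⊩_ ℙ q φ ⊎ _⊩_ ℙ q (¬ₛ φ)

  module _ (lem : ExcludedMiddle 0ℓ) where

    decides-dense : ∀ r φ → Σ P λ q → r ⊑ q × Decides q φ
    decides-dense r φ with lem {Σ P λ q → r ⊑ q × _⊩_ ℙ q φ}
    ... | yes (q , r⊑q , q⊩φ) = q , r⊑q , inj₁ q⊩φ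
    ... | no  ∄q              = r , ⊑-refl , inj₂ λ q r⊑q q⊩φ → ∄q (q , r⊑q , q⊩φ)

    decides-subsingleton : (S : Sen [] → Set) → (∀ {φ ψ} → S φ → S ψ → φ ≡ ψ) →
                           ∀ r → Σ P λ q → r ⊑ q × (∀ φ → S φ → Decides q φ)
    decides-subsingleton S unique r with lem {Σ (Sen []) S}
    ... | no  ∄φ       = r , ⊑-refl , λ φ Sφ → contradiction (φ , Sφ) ∄φ
    ... | yes (ψ , Sψ) with decides-dense r ψ
    ...   | q , r⊑q , q-decides-ψ =
            q , r⊑q , λ φ Sφ → subst (Decides q) (unique Sψ Sφ) q-decides-ψ

module GenericConstruction (lem : ExcludedMiddle 0ℓ) {A : Sig} (ℙ : ForcingProperty {A})
                           (countable : ∀ p → AtMostCountable (ForcingProperty.Δ ℙ p))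
                           (p₀ : ForcingProperty.P ℙ) where
  open ForcingProperty ℙ renaming (_≤_ to _⊑_)
  open IsPartialOrder ≤-isPartialOrder using () renaming (refl to ⊑-refl; trans to ⊑-trans)
  open SentenceCode using (senCode; senCode-injective)

  CodedBy : P → ℕ → Sen [] → Set
  CodedBy s k φ = Σ (SenIn (Δ s) φ) λ h → senCode (Δ s) (countable s) φ h ≡ k

  CodedBy-unique : ∀ {s k φ ψ} → CodedBy s k φ → CodedBy s k ψ → φ ≡ ψ
  CodedBy-unique {s} {φ = φ} {ψ} (hφ , refl) (hψ , eψ) =
    senCode-injective (Δ s) (countable s) φ ψ hφ hψ (sym eψ)

  decideCoded : ∀ s k r → Σ P λ q → r ⊑ q × (∀ φ → CodedBy s k φ → Decides ℙ q φ)
  decideCoded s k = decides-subsingleton ℙ lem (CodedBy s k) CodedBy-unique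

  next : ℕ → (ℕ → P) → P
  next m stage = proj₁ (decideCoded (stage (proj₁ (unpair m))) (proj₂ (unpair m)) (stage m))

  open CourseOfValues p₀ next using (value; value-suc; table-stable)

  value-⊑-suc : ∀ m → value m ⊑ value (suc m)
  value-⊑-suc m rewrite value-suc m = proj₁ (proj₂ (decideCoded _ _ (value m)))

  value-mono : ∀ {i m} → i ≤ m → value i ⊑ value m
  value-mono i≤m = mono′ (≤⇒≤′ i≤m)
    where
    mono′ : ∀ {i m} → i ≤′ m → value i ⊑ value m
    mono′ (≤′-reflexive refl)        = ⊑-refl
    mono′ {m = suc m} (≤′-step i≤′m) = ⊑-trans (mono′ i≤′m) (value-⊑-suc m)

  value-suc-decides : ∀ m {n k} → unpair m ≡ (n , k) →
                      ∀ φ → CodedBy (value n) k φ → Decides ℙ (value (suc m)) φ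
  value-suc-decides m refl
    rewrite value-suc m | table-stable (unpair-proj₁-≤ m) = proj₂ (proj₂ (decideCoded _ _ (value m)))

  G : P → Set
  G q = ∃ λ m → q ⊑ value m

  p₀∈G : G p₀
  p₀∈G = zero , ⊑-refl

  G-generic : Generic ℙ G
  G-generic = record
    { down     = λ { (m , q⊑) p⊑q → m , ⊑-trans p⊑q q⊑ }
    ; directed = λ { (a , p⊑) (b , q⊑) →
        value (a ⊔ b) , (a ⊔ b , ⊑-refl) ,
        ⊑-trans p⊑ (value-mono (m≤m⊔n a b)) , ⊑-trans q⊑ (value-mono (m≤n⊔m a b)) }
    ; decides  = decide
    }
    where
    decide : ∀ {q} → G q → (φ : Sen []) → SenIn (Δ q) φ →
             Σ P λ r → G r × q ⊑ r × Decides ℙ r φ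
    decide {q} (n , q⊑) φ φ∈ =
      value (suc m) , (suc m , ⊑-refl) ,
      ⊑-trans q⊑ (⊑-trans (value-mono n≤m) (value-⊑-suc m)) ,
      value-suc-decides m unpair-m φ (φ∈ₙ , refl)
      where
      φ∈ₙ : SenIn (Δ (value n)) φ
      φ∈ₙ = SenIn-mono (Δ-mono q⊑) φ φ∈
      k : ℕ
      k = senCode (Δ (value n)) (countable (value n)) φ φ∈ₙ
      m : ℕ
      m = proj₁ (unpair-surjective (n , k))
      unpair-m : unpair m ≡ (n , k)
      unpair-m = proj₂ (unpair-surjective (n , k))
      n≤m : n ≤ m
      n≤m = subst (_≤ m) (cong proj₁ unpair-m) (unpair-proj₁-≤ m)

lemma4p6 : ExcludedMiddle 0ℓ →
    (A : Sig) (ℙ : ForcingProperty {A}) →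
    (∀ p → AtMostCountable (ForcingProperty.Δ ℙ p)) →
    ∀ p → Σ (ForcingProperty.P ℙ → Set) (λ G → Generic ℙ G × G p)
lemma4p6 lem A ℙ countable p = G , G-generic , p₀∈G
  where open GenericConstruction lem ℙ countable p
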